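{- Let $\vdash$ be a regular entailment relation for a commutative preordered group $G$. For all $a,b,x\in G$ we have $a,b\vdash a+x,b-x$ and $a+x,b-x\vdash a,b$. In particular $a\vdash a+x,a-x$ and $a+x,a-x\vdash a$.
   Context: A commutative preordered group is an abelian group $G$ with a preorder $\leqslant$ such that $a\leqslant b$ implies $a+c\leqslant b+c$. Below, $A,B,A',B'$ denote nonempty finite subsets of $G$; we write $a$ for $\{a\}$, $A,B$ (and $a,b$ etc.) for unions, $A+x=\{a+x:a\in A\}$. A regular entailment relation for $G$ is a relation $A\vdash B$ between nonempty finite subsets of $G$ such that: (R1) $A\vdash B$ if $A\supseteq A'$, $B\supseteq B'$ and $A'\vdash B'$; (R2) $A\vdash B$ if $A,x\vdash B$ and $A\vdash B,x$; (R3) $a\vdash b$ if $a\leqslant b$; (R4) $A\vdash B$ if $A+x\vdash B+x$; (R5) $a+x,b+y\vdash a+b,x+y$ for all $a,b,x,y\in G$. -}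

module Defs where

open import Level using (Level; _⊔_; suc)
open import Data.Product using (_×_)
open import Data.List.NonEmpty using (List⁺; [_]; _⁺++⁺_; _∷⁺_; toList) renaming (map to map⁺)
open import Data.List.Membership.Propositional using (_∈_)
open import Relation.Binary.PropositionalEquality using (_≡_)
open import Relation.Binary.Structures using (IsPreorder)
open import Algebra.Structures using (IsAbelianGroup)

record PreorderedAbGroup (c ℓ : Level) : Set (suc (c ⊔ ℓ)) where
  infixl 6 _+_ _-_
  infix 4 _≤_
  field
    Carrier : Set c
    _+_ : Carrier → Carrier → Carrier
    0g : Carrier
    -_ : Carrier → Carrier
    _≤_ : Carrier → Carrier → Set ℓ
    isAbelianGroup : IsAbelianGroup _≡_ _+_ 0g -_
    isPreorder : IsPreorder _≡_ _≤_
    +-mono : ∀ {a b} c → a ≤ b → a + c ≤ b + c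
  _-_ : Carrier → Carrier → Carrier
  a - b = a + (- b)

module _ {c ℓ : Level} (G : PreorderedAbGroup c ℓ) where
  open PreorderedAbGroup G

  -- Nonempty finite subsets of G, represented by nonempty lists
  -- (only membership matters, by R1).
  FinSub : Set c
  FinSub = List⁺ Carrier

  _⊇_ : FinSub → FinSub → Set c
  A ⊇ A' = ∀ {z} → z ∈ toList A' → z ∈ toList A

  _+ₛ_ : FinSub → Carrier → FinSub
  A +ₛ x = map⁺ (λ a → a + x) A

  -- Regular entailment relation for G (axioms R1–R5); unions are list appends.
  record IsRegularEntailment {ℓ' : Level} (_⊢_ : FinSub → FinSub → Set ℓ') : Set (c ⊔ ℓ ⊔ ℓ') where
    field
      R1 : ∀ {A B A' B'} → A ⊇ A' → B ⊇ B' → A' ⊢ B' → A ⊢ B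
      R2 : ∀ {A B} x → (A ⁺++⁺ [ x ]) ⊢ B → A ⊢ (B ⁺++⁺ [ x ]) → A ⊢ B
      R3 : ∀ {a b} → a ≤ b → [ a ] ⊢ [ b ]
      R4 : ∀ {A B} x → (A +ₛ x) ⊢ (B +ₛ x) → A ⊢ B
      R5 : ∀ a b x y → ((a + x) ∷⁺ [ b + y ]) ⊢ ((a + b) ∷⁺ [ x + y ])

module Submission where

open import Defs
open import Level using (Level)
open import Data.Product using (_×_; _,_)
open import Data.List.NonEmpty using ([_]; _∷⁺_)
open import Data.List.Relation.Unary.Any using (here; there)
open import Relation.Binary.PropositionalEquality using (_≡_; refl; sym; trans)
open import Algebra.Bundles using (AbelianGroup)
import Algebra.Properties.AbelianGroup as AbelianGroupProperties

module _ {c ℓ : Level} (G : PreorderedAbGroup c ℓ) where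
  open PreorderedAbGroup G

  abelianGroup : AbelianGroup c c
  abelianGroup = record
    { Carrier = Carrier ; _≈_ = _≡_ ; _∙_ = _+_ ; ε = 0g ; _⁻¹ = -_
    ; isAbelianGroup = isAbelianGroup }

  open AbelianGroup abelianGroup using (assoc; identityˡ; identityʳ)
  open AbelianGroupProperties abelianGroup using (xyx⁻¹≈y)

  x+[y-x]≡y : ∀ x y → x + (y - x) ≡ y
  x+[y-x]≡y x y = trans (sym (assoc x y (- x))) (xyx⁻¹≈y x y)

  [a]⊇a,a : ∀ a → _⊇_ G [ a ] (a ∷⁺ [ a ])
  [a]⊇a,a a (here a∈) = here a∈
  [a]⊇a,a a (there (here a∈)) = here a∈

  module _ {ℓ' : Level} {_⊢_ : FinSub G → FinSub G → Set ℓ'}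
           (E : IsRegularEntailment G _⊢_) where
    open IsRegularEntailment E

    R5-≡ : ∀ a b x y {p q r s} → a + x ≡ p → b + y ≡ q → a + b ≡ r → x + y ≡ s
         → (p ∷⁺ [ q ]) ⊢ (r ∷⁺ [ s ])
    R5-≡ a b x y refl refl refl refl = R5 a b x y

    ⊢-contractˡ : ∀ {a B} → (a ∷⁺ [ a ]) ⊢ B → [ a ] ⊢ B
    ⊢-contractˡ = R1 ([a]⊇a,a _) (λ z∈ → z∈)

    ⊢-contractʳ : ∀ {A b} → A ⊢ (b ∷⁺ [ b ]) → A ⊢ [ b ]
    ⊢-contractʳ = R1 (λ z∈ → z∈) ([a]⊇a,a _)

    pair⊢shifted : ∀ a b x → (a ∷⁺ [ b ]) ⊢ ((a + x) ∷⁺ [ b - x ])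
    pair⊢shifted a b x =
      R5-≡ a x 0g (b - x) (identityʳ a) (x+[y-x]≡y x b) refl (identityˡ (b - x))

    shifted⊢pair : ∀ a b x → ((a + x) ∷⁺ [ b - x ]) ⊢ (a ∷⁺ [ b ])
    shifted⊢pair a b x =
      R5-≡ a 0g x (b - x) refl (identityˡ (b - x)) (identityʳ a) (x+[y-x]≡y x b)

proposition1p1 : {c ℓ ℓ' : Level} (G : PreorderedAbGroup c ℓ)
    → let open PreorderedAbGroup G in
    (_⊢_ : FinSub G → FinSub G → Set ℓ') → IsRegularEntailment G _⊢_
    → (∀ a b x → ((a ∷⁺ [ b ]) ⊢ ((a + x) ∷⁺ [ b - x ]))
    × (((a + x) ∷⁺ [ b - x ]) ⊢ (a ∷⁺ [ b ])))
    × (∀ a x → ([ a ] ⊢ ((a + x) ∷⁺ [ a - x ]))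
    × (((a + x) ∷⁺ [ a - x ]) ⊢ [ a ]))
proposition1p1 G _⊢_ E =
    (λ a b x → pair⊢shifted G E a b x , shifted⊢pair G E a b x)
  , (λ a x → ⊢-contractˡ G E (pair⊢shifted G E a a x)
           , ⊢-contractʳ G E (shifted⊢pair G E a a x))
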